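{- Let $m \geq 2$ and $n \geq 2$ be integers and let $\Sigma$ be an alphabet with at least four symbols. Consider the decision problem: given a coloring $c : [m] \times [n] \to \Sigma$, accessible only by querying the value $c(i,j)$ of individual cells, decide whether the grid graph $G_c$ contains a cycle. Then every deterministic algorithm that correctly decides this problem for all colorings must, in the worst case, query all $mn$ cells.
   Context: For a coloring $c : [m] \times [n] \to \Sigma$ of the cells of an $m \times n$ grid, the grid graph $G_c$ has vertex set $[m] \times [n]$ and an (undirected) edge between $(i,j)$ and $(i',j')$ if and only if $|i-i'| + |j-j'| = 1$ and $c(i,j) = c(i',j')$. A cycle means a cycle in this undirected simple graph. A deterministic algorithm adaptively chooses which cell to query next based on the answers received so far, and must eventually output whether $G_c$ has a cycle. -}

module Defs where

open import Data.Nat using (ℕ; suc; _+_; _≤_; ∣_-_∣)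
open import Data.Fin using (Fin; toℕ; inject₁; fromℕ; zero) renaming (suc to fsuc)
open import Data.Bool using (Bool)
open import Data.Product using (Σ; _×_; ∃)
open import Relation.Binary.PropositionalEquality using (_≡_)
open import Function.Definitions using (Injective)

Cell : ℕ → ℕ → Set
Cell m n = Fin m × Fin n

Coloring : ℕ → ℕ → ℕ → Set
Coloring m n k = Fin m → Fin n → Fin k

colorOf : ∀ {m n k} → Coloring m n k → Cell m n → Fin k
colorOf c (i Data.Product., j) = c i j

GridAdj : ∀ {m n} → Cell m n → Cell m n → Set
GridAdj (i Data.Product., j) (i' Data.Product., j') =
  ∣ toℕ i - toℕ i' ∣ + ∣ toℕ j - toℕ j' ∣ ≡ 1

Edge : ∀ {m n k} → Coloring m n k → Cell m n → Cell m n → Set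
Edge c u v = GridAdj u v × colorOf c u ≡ colorOf c v

-- A cycle of length r + 3 (≥ 3) in G_c: an injective cyclic sequence
-- of vertices with consecutive vertices (and last/first) adjacent.
record Cycle {m n k} (c : Coloring m n k) (r : ℕ) : Set where
  field
    vertex   : Fin (suc (suc (suc r))) → Cell m n
    distinct : Injective _≡_ _≡_ vertex
    step     : (x : Fin (suc (suc r))) → Edge c (vertex (inject₁ x)) (vertex (fsuc x))
    close    : Edge c (vertex (fromℕ (suc (suc r)))) (vertex zero)

HasCycle : ∀ {m n k} → Coloring m n k → Set
HasCycle c = ∃ λ r → Cycle c r

-- Deterministic adaptive query algorithms = decision trees:
-- either output an answer, or query a cell and branch on its color.
data Tree (m n k : ℕ) : Set where
  leaf : Bool → Tree m n k
  ask  : Fin m → Fin n → (Fin k → Tree m n k) → Tree m n k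

eval : ∀ {m n k} → Tree m n k → Coloring m n k → Bool
eval (leaf b)    c = b
eval (ask i j f) c = eval (f (c i j)) c

data Queried {m n k} : Tree m n k → Coloring m n k → Fin m → Fin n → Set where
  here  : ∀ {i j f c} → Queried (ask i j f) c i j
  there : ∀ {i j f c a b} → Queried (f (c i j)) c a b → Queried (ask i j f) c a b

{-# OPTIONS --safe #-}
module Submission where

-- Adversary argument. Cut the grid into blocks of 2 or 3 rows by 2 or 3 columns and tint
-- each block by the parity of its block coordinates, so that blocks sharing a side have
-- different tints. Each block uses the two colours of its tint, a base colour and a marked
-- one; hence no monochromatic edge leaves a block. The adversary marks a cell when it is the
-- last cell of its block to be queried; in a 2 × 3 block also the cell that completes the
-- first of the two end columns (end rows for 3 × 2), and in a 3 × 3 block the centre and the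
-- last cell of the surrounding ring. For every order of queries the resulting colouring is
-- acyclic, while giving the very last queried cell its base colour closes a square or the
-- ring. So before the last cell is queried both answers are still possible.
--
-- Acyclicity uses a height function under which every vertex has at most one lower
-- neighbour of its own colour; the top of a cycle would have two. Inside a block the final
-- pattern depends only on the latest cells of a few fixed sets, so there are finitely many
-- patterns, and their heights and closing loops are checked by evaluation.

open import Defs
open import Data.Bool using (Bool; true; false; not; _∧_; _∨_; T; if_then_else_)
open import Data.Bool.Properties using () renaming (_≟_ to _≟ᵇ_)
open import Data.Empty using (⊥; ⊥-elim)
open import Data.Fin using (Fin; toℕ; fromℕ<; inject≤; inject₁; fromℕ)
  renaming (zero to fzero; suc to fsuc)
import Data.Fin.Properties as Fin
open import Data.List using (List; []; _∷_; _++_; length; map; filter; head; upTo; allFin; cartesianProduct)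
open import Data.List.Extrema.Nat using (argmax; argmax-sel; f[⊥]≤f[argmax]; f[xs]≤f[argmax])
open import Data.List.Membership.Propositional using (_∈_; _∉_)
open import Data.List.Membership.Propositional.Properties
  using ( ∈-++⁻; ∈-++⁺ˡ; ∈-++⁺ʳ; ∈-map⁺; ∈-map⁻; ∈-upTo⁺; ∈-upTo⁻; ∈-allFin; ∈-cartesianProduct⁺
        ; ∈-filter⁺; ∈-filter⁻)
import Data.List.Membership.DecPropositional as DecMembership
open import Data.List.Properties using (++-assoc; ++-identityʳ)
open import Data.List.Relation.Binary.Subset.Propositional using (_⊆_)
import Data.List.Relation.Binary.Subset.DecPropositional as DecSubset
open import Data.List.Relation.Unary.All as All using (All)
open import Data.List.Relation.Unary.All.Properties using (¬All⇒Any¬)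
open import Data.List.Relation.Unary.Any as Any using (Any; here; there)
open import Data.Maybe using (fromMaybe)
open import Data.Nat
  using (ℕ; zero; suc; _+_; _*_; _∸_; _≤_; _<_; _<ᵇ_; _≟_; z≤n; s≤s; z<s; s<s; ∣_-_∣; parity)
open import Data.Nat.Properties
  using ( _<?_; <ᵇ⇒<; <⇒<ᵇ; ≤⇒≯; ≤∧≢⇒<; <⇒≤; ≤-refl; ≤-reflexive; ≤-antisym; ≤-pred; m<n⇒m<1+n
        ; n<1+n; m≤m+n; +-identityʳ; suc-injective; m≢1+n+m; ∣-∣-comm; ∣m+n-m+o∣≡∣n-o∣; ∣m-n∣≡0⇒m≡n
        ; module ≤-Reasoning)
import Data.Nat.Properties as ℕ
open import Data.Parity using (Parity; 0ℙ; 1ℙ) renaming (_+_ to _⊹_)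
open import Data.Parity.Properties using (suc-homo-⁻¹; p≢p⁻¹)
  renaming (+-cancelˡ-≡ to ⊹-cancelˡ-≡; +-cancelʳ-≡ to ⊹-cancelʳ-≡)
open import Data.Product using (Σ; _×_; _,_; proj₁; proj₂; ∃; ∃₂)
open import Data.Product.Properties using (≡-dec; ,-injective)
open import Data.Sum using (_⊎_; inj₁; inj₂; [_,_]′)
import Data.Sum as Sum
open import Data.Vec using (Vec; lookup; fromList)
open import Function using (_∘_; id; _⇔_; mk⇔; Equivalence)
open import Function.Definitions using (Injective)
open import Relation.Binary.Definitions using (DecidableEquality)
open import Relation.Binary.PropositionalEquality
  using (_≡_; _≢_; refl; sym; trans; cong; cong₂; subst; subst₂; module ≡-Reasoning)
open import Relation.Nullary using (Dec; ¬_; does; yes; no; ¬?; contradiction)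
open import Relation.Nullary.Decidable
  using (True; _×-dec_; _⊎-dec_; _→-dec_; toWitness; T?; does-⇔; map′)

-- Acyclicity from a height function

Edge-sym : ∀ {m n k} (c : Coloring m n k) {u w} → Edge c u w → Edge c w u
Edge-sym c {i , j} {i′ , j′} (adj , same) =
  trans (cong₂ _+_ (∣-∣-comm (toℕ i′) (toℕ i)) (∣-∣-comm (toℕ j′) (toℕ j))) adj , sym same

last-or-inject₁ : ∀ {n} (y : Fin (suc n)) → y ≡ fromℕ n ⊎ ∃ λ z → y ≡ inject₁ z
last-or-inject₁ {zero} fzero = inj₁ refl
last-or-inject₁ {suc n} fzero = inj₂ (fzero , refl)
last-or-inject₁ {suc n} (fsuc y) =
  Sum.map (cong fsuc) (λ (z , y≡z) → fsuc z , cong fsuc y≡z) (last-or-inject₁ y)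

module _ {m n k} {c : Coloring m n k} {r} (cycle : Cycle c r) where
  open Cycle cycle

  two-neighbours : ∀ p → ∃₂ λ a b →
                   a ≢ b × Edge c (vertex p) (vertex a) × Edge c (vertex p) (vertex b)
  two-neighbours fzero = fsuc fzero , fromℕ (suc (suc r)) , (λ ()) , step fzero , Edge-sym c close
  two-neighbours (fsuc y) with last-or-inject₁ y
  ... | inj₁ refl = inject₁ y , fzero , (λ ()) , Edge-sym c (step y) , close
  ... | inj₂ (z , refl) = inject₁ y , fsuc (fsuc z) , inject₁≢ , Edge-sym c (step y) , step (fsuc z)
    where
    inject₁≢ : inject₁ (inject₁ z) ≢ fsuc (fsuc z)
    inject₁≢ eq = m≢1+n+m (toℕ z)
      (trans (sym (trans (Fin.toℕ-inject₁ (inject₁ z)) (Fin.toℕ-inject₁ z))) (cong toℕ eq))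

maximum-exists : ∀ {n} (f : Fin (suc n) → ℕ) → ∃ λ top → ∀ x → f x ≤ f top
maximum-exists f =
  argmax f fzero (allFin _) , λ x → All.lookup (f[xs]≤f[argmax] {f = f} fzero (allFin _)) (∈-allFin x)

acyclic-by-height : ∀ {m n k} (c : Coloring m n k) (height : Cell m n → ℕ) →
  (∀ {u w} → Edge c u w → height u ≢ height w) →
  (∀ {u w w′} → Edge c u w → Edge c u w′ → height w < height u → height w′ < height u → w ≡ w′) →
  ¬ HasCycle c
acyclic-by-height c height separated one-lower (r , cycle) = peak (maximum-exists (height ∘ vertex))
  where
  open Cycle cycle
  peak : (∃ λ top → ∀ x → height (vertex x) ≤ height (vertex top)) → ⊥
  peak (top , highest) with two-neighbours cycle top
  ... | a , b , a≢b , ea , eb = a≢b (distinct (one-lower ea eb (below ea) (below eb)))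
    where
    below : ∀ {x} → Edge c (vertex top) (vertex x) → height (vertex x) < height (vertex top)
    below {x} e = ≤∧≢⇒< (highest x) (separated e ∘ sym)

-- Adversaries against decision trees

<ᵇ-false : ∀ {m n} → n ≤ m → (m <ᵇ n) ≡ false
<ᵇ-false {m} {n} n≤m with m <ᵇ n in eq
... | false = refl
... | true = contradiction (<ᵇ⇒< m n (subst T (sym eq) _)) (≤⇒≯ n≤m)

module Rank {a} {A : Set a} (_≟ₐ_ : DecidableEquality A) where

  rank : List A → A → ℕ
  rank [] x = 0
  rank (y ∷ ys) x = if does (y ≟ₐ x) then 0 else suc (rank ys x)

  rank-∈ : ∀ {x xs} → x ∈ xs → rank xs x < length xs
  rank-∈ {x} {y ∷ ys} x∈ with y ≟ₐ x
  ... | yes _ = z<s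
  ... | no y≢x = s<s (rank-∈ (Any.tail (y≢x ∘ sym) x∈))

  rank-∉ : ∀ {x xs} → x ∉ xs → rank xs x ≡ length xs
  rank-∉ {x} {[]} _ = refl
  rank-∉ {x} {y ∷ ys} x∉ with y ≟ₐ x
  ... | yes refl = contradiction (here refl) x∉
  ... | no _ = cong suc (rank-∉ (x∉ ∘ there))

  rank-++-∈ : ∀ {x xs} ys → x ∈ xs → rank (xs ++ ys) x ≡ rank xs x
  rank-++-∈ {x} {y ∷ xs} ys x∈ with y ≟ₐ x
  ... | yes _ = refl
  ... | no y≢x = cong suc (rank-++-∈ ys (Any.tail (y≢x ∘ sym) x∈))

  rank-++-∉ : ∀ {x xs} ys → x ∉ xs → rank (xs ++ ys) x ≡ length xs + rank ys x
  rank-++-∉ {x} {[]} ys _ = refl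
  rank-++-∉ {x} {y ∷ xs} ys x∉ with y ≟ₐ x
  ... | yes refl = contradiction (here refl) x∉
  ... | no _ = cong suc (rank-++-∉ ys (x∉ ∘ there))

  rank-head : ∀ x xs → rank (x ∷ xs) x ≡ 0
  rank-head x xs with x ≟ₐ x
  ... | yes _ = refl
  ... | no x≢x = contradiction refl x≢x

  rank-last-max : ∀ {x} xs → x ∉ xs → ∀ y → y ∈ xs ++ x ∷ [] →
                  rank (xs ++ x ∷ []) y ≤ rank (xs ++ x ∷ []) x
  rank-last-max {x} xs x∉xs y y∈ =
    subst (rank (xs ++ x ∷ []) y ≤_) (sym last-rank) (bounded (∈-++⁻ xs y∈))
    where
    last-rank : rank (xs ++ x ∷ []) x ≡ length xs
    last-rank =
      trans (rank-++-∉ (x ∷ []) x∉xs) (trans (cong (length xs +_) (rank-head x [])) (+-identityʳ _))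
    bounded : y ∈ xs ⊎ y ∈ x ∷ [] → rank (xs ++ x ∷ []) y ≤ length xs
    bounded (inj₁ y∈xs) =
      <⇒≤ (subst (_< length xs) (sym (rank-++-∈ (x ∷ []) y∈xs)) (rank-∈ y∈xs))
    bounded (inj₂ (here refl)) = ≤-reflexive last-rank

  rank-injective : ∀ {x x′ xs} → x ∈ xs → x′ ∈ xs → rank xs x ≡ rank xs x′ → x ≡ x′
  rank-injective {x} {x′} {y ∷ ys} x∈ x′∈ eq with y ≟ₐ x | y ≟ₐ x′
  ... | yes refl | yes refl = refl
  ... | no y≢x | no y≢x′ =
    rank-injective (Any.tail (y≢x ∘ sym) x∈) (Any.tail (y≢x′ ∘ sym) x′∈) (suc-injective eq)

_≟ᶜ_ : ∀ {m n} → DecidableEquality (Cell m n)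
_≟ᶜ_ = ≡-dec Fin._≟_ Fin._≟_

recolour : ∀ {m n k} → Coloring m n k → Cell m n → Fin k → Coloring m n k
recolour c v a i j = if does ((i , j) ≟ᶜ v) then a else c i j

cells : ∀ m n → List (Cell m n)
cells m n = cartesianProduct (allFin m) (allFin n)

∈-cells : ∀ {m n} (u : Cell m n) → u ∈ cells m n
∈-cells (i , j) = ∈-cartesianProduct⁺ (∈-allFin i) (∈-allFin j)

module Adversary {m n k} (W : (Cell m n → ℕ) → Coloring m n k)
  (online : ∀ ρ ρ′ u → (∀ z → (ρ z <ᵇ ρ u) ≡ (ρ′ z <ᵇ ρ′ u)) →
            colorOf (W ρ) u ≡ colorOf (W ρ′) u)
  (P : Coloring m n k → Set)
  (switch : ∀ ρ → Injective _≡_ _≡_ ρ → ∀ v → (∀ z → ρ z ≤ ρ v) →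
            ∃ λ a → ¬ P (W ρ) × P (recolour (W ρ) v a))
  where

  open Rank (_≟ᶜ_ {m} {n})
  open DecMembership (_≟ᶜ_ {m} {n}) using (_∈?_)

  Consistent : List (Cell m n) → Coloring m n k → Set
  Consistent H c = ∀ {u} → u ∈ H → colorOf c u ≡ colorOf (W (rank H)) u

  stable : ∀ H R {u} → u ∈ H → colorOf (W (rank (H ++ R))) u ≡ colorOf (W (rank H)) u
  stable H R {u} u∈H = online _ _ u same-order
    where
    same-order : ∀ z → (rank (H ++ R) z <ᵇ rank (H ++ R) u) ≡ (rank H z <ᵇ rank H u)
    same-order z with z ∈? H
    ... | yes z∈H = cong₂ _<ᵇ_ (rank-++-∈ R z∈H) (rank-++-∈ R u∈H)
    ... | no z∉H = trans (<ᵇ-false u-before-z)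
                         (sym (<ᵇ-false (<⇒≤ (subst (rank H u <_) (sym (rank-∉ z∉H)) (rank-∈ u∈H)))))
      where
      u-before-z : rank (H ++ R) u ≤ rank (H ++ R) z
      u-before-z = begin
        rank (H ++ R) u      ≡⟨ rank-++-∈ R u∈H ⟩
        rank H u             <⟨ rank-∈ u∈H ⟩
        length H             ≤⟨ m≤m+n _ _ ⟩
        length H + rank R z  ≡⟨ rank-++-∉ R z∉H ⟨
        rank (H ++ R) z      ∎
        where open ≤-Reasoning

  restrict : ∀ H {R c} → Consistent (H ++ R) c → Consistent H c
  restrict H {R} consistent u∈H = trans (consistent (∈-++⁺ˡ u∈H)) (stable H R u∈H)

  -- An unqueried cell us is ranked last: the strategy's colouring and its recolouring at us
  -- both agree with every answer given so far, and exactly one of them satisfies P.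
  undecided : ∀ {b} H {us} → us ∉ H → ¬ (∀ c → Consistent H c → (b ≡ true ⇔ P c))
  undecided H {us} us∉H correct =
    let a , ¬P₀ , P₁ = switch ρ ρ-injective us ρ-max
        b≡true = Equivalence.from (correct (recolour (W ρ) us a) (consistent-recoloured a)) P₁
    in ¬P₀ (Equivalence.to (correct (W ρ) (stable H R)) b≡true)
    where
    others R : List (Cell m n)
    others = filter (λ z → ¬? (z ≟ᶜ us)) (cells m n)
    R = others ++ us ∷ []
    ρ : Cell m n → ℕ
    ρ = rank (H ++ R)
    everywhere : ∀ z → z ∈ H ++ R
    everywhere z with z ≟ᶜ us
    ... | yes refl = ∈-++⁺ʳ H (∈-++⁺ʳ others (here refl))
    ... | no z≢us = ∈-++⁺ʳ H (∈-++⁺ˡ (∈-filter⁺ _ (∈-cells z) z≢us))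
    ρ-injective : Injective _≡_ _≡_ ρ
    ρ-injective = rank-injective (everywhere _) (everywhere _)
    ρ-max : ∀ z → ρ z ≤ ρ us
    ρ-max z = subst (λ L → rank L z ≤ rank L us) (++-assoc H others (us ∷ []))
      (rank-last-max (H ++ others) us∉ z
        (subst (z ∈_) (sym (++-assoc H others (us ∷ []))) (everywhere z)))
      where
      us∉ : us ∉ H ++ others
      us∉ us∈ with ∈-++⁻ H us∈
      ... | inj₁ us∈H = us∉H us∈H
      ... | inj₂ us∈others = ∈-filter⁻ _ {xs = cells m n} us∈others .proj₂ refl
    consistent-recoloured : ∀ a → Consistent H (recolour (W ρ) us a)
    consistent-recoloured a {u} u∈H with u ≟ᶜ us
    ... | yes refl = contradiction u∈H us∉H
    ... | no _ = stable H R u∈H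

  play : ∀ t H → (∀ c → Consistent H c → (eval t c ≡ true ⇔ P c)) →
         ∃ λ c → Consistent H c × (∀ u → u ∉ H → Queried t c (proj₁ u) (proj₂ u))
  play (leaf b) H correct with All.all? (_∈? H) (cells m n)
  ... | yes all∈H =
    W (rank H) , (λ _ → refl) , λ u u∉H → contradiction (All.lookup all∈H (∈-cells u)) u∉H
  ... | no missing =
    ⊥-elim (undecided H (Any.satisfied (¬All⇒Any¬ (_∈? H) _ missing) .proj₂) correct)
  play (ask i j f) H correct with play (f a) H′ correct′
    where
    H′ : List (Cell m n)
    H′ = H ++ (i , j) ∷ []
    a : Fin k
    a = colorOf (W (rank H′)) (i , j)
    correct′ : ∀ c → Consistent H′ c → (eval (f a) c ≡ true ⇔ P c)
    correct′ c consistent =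
      subst (λ x → eval (f x) c ≡ true ⇔ P c) (consistent (∈-++⁺ʳ H (here refl)))
        (correct c (restrict H consistent))
  ... | c , consistent , queried = c , restrict H consistent , covered
    where
    covered : ∀ u → u ∉ H → Queried (ask i j f) c (proj₁ u) (proj₂ u)
    covered u u∉H with (i , j) ≟ᶜ u
    ... | yes refl = here
    ... | no ij≢u = there (subst (λ x → Queried (f x) c (proj₁ u) (proj₂ u))
                              (sym (consistent (∈-++⁺ʳ H (here refl))))
                              (queried u (u∉H′ ∘ ∈-++⁻ H)))
      where
      u∉H′ : ¬ (u ∈ H ⊎ u ∈ (i , j) ∷ [])
      u∉H′ (inj₁ u∈H) = u∉H u∈H
      u∉H′ (inj₂ (here u≡ij)) = ij≢u (sym u≡ij)

  evasive : (t : Tree m n k) → (∀ c → (eval t c ≡ true) ⇔ P c) → ∃ λ c → ∀ i j → Queried t c i j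
  evasive t correct =
    let c , _ , queried = play t [] (λ c _ → correct c) in c , λ i j → queried (i , j) λ ()

-- Inside one block

Point : Set
Point = ℕ × ℕ

infix 4 _≟ₚ_ _==_

_≟ₚ_ : DecidableEquality Point
_≟ₚ_ = ≡-dec _≟_ _≟_

_==_ : Point → Point → Bool
p == q = does (p ≟ₚ q)

open DecMembership _≟ₚ_ using (_∈?_)
open DecSubset _≟ₚ_ using (_⊆?_)

_⊕_ : Point → Point → Point
(a , b) ⊕ (c , d) = a + c , b + d

⊕-cancel : ∀ o {p q} → o ⊕ p ≡ o ⊕ q → p ≡ q
⊕-cancel (x , y) eq =
  let eq₁ , eq₂ = ,-injective eq in cong₂ _,_ (ℕ.+-cancelˡ-≡ x _ _ eq₁) (ℕ.+-cancelˡ-≡ y _ _ eq₂)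

Adjacent : Point → Point → Set
Adjacent (a , b) (c , d) = ∣ a - c ∣ + ∣ b - d ∣ ≡ 1

adjacent? : ∀ p q → Dec (Adjacent p q)
adjacent? (a , b) (c , d) = ∣ a - c ∣ + ∣ b - d ∣ ≟ 1

⊕-adjacent⁻ : ∀ o {p q} → Adjacent (o ⊕ p) (o ⊕ q) → Adjacent p q
⊕-adjacent⁻ (x , y) {a , b} {c , d} adj =
  trans (sym (cong₂ _+_ (∣m+n-m+o∣≡∣n-o∣ x a c) (∣m+n-m+o∣≡∣n-o∣ y b d))) adj

⊕-adjacent⁺ : ∀ o {p q} → Adjacent p q → Adjacent (o ⊕ p) (o ⊕ q)
⊕-adjacent⁺ (x , y) {a , b} {c , d} adj =
  trans (cong₂ _+_ (∣m+n-m+o∣≡∣n-o∣ x a c) (∣m+n-m+o∣≡∣n-o∣ y b d)) adj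

distance-one : ∀ {x y} → ∣ x - y ∣ ≡ 1 → y ≡ suc x ⊎ x ≡ suc y
distance-one {zero} {suc zero} _ = inj₁ refl
distance-one {suc zero} {zero} _ = inj₂ refl
distance-one {suc x} {suc y} d = Sum.map (cong suc) (cong suc) (distance-one d)

adjacent-split : ∀ {a b c d} → Adjacent (a , b) (c , d) →
                 (a ≡ c × ∣ b - d ∣ ≡ 1) ⊎ (∣ a - c ∣ ≡ 1 × b ≡ d)
adjacent-split {a} {b} {c} {d} adj with ∣ a - c ∣ in eq-row | ∣ b - d ∣ in eq-column
... | zero | _ = inj₁ (∣m-n∣≡0⇒m≡n eq-row , adj)
... | suc zero | zero = inj₂ (refl , ∣m-n∣≡0⇒m≡n eq-column)

box : ℕ → ℕ → List Point
box zero w = []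
box (suc h) w = box h w ++ map (h ,_) (upTo w)

∈-box⁺ : ∀ {h w a b} → a < h → b < w → (a , b) ∈ box h w
∈-box⁺ {suc h} {w} {a} a<1+h b<w with a ≟ h
... | yes refl = ∈-++⁺ʳ (box h w) (∈-map⁺ (a ,_) (∈-upTo⁺ b<w))
... | no a≢h = ∈-++⁺ˡ (∈-box⁺ (≤∧≢⇒< (≤-pred a<1+h) a≢h) b<w)

∈-box⁻ : ∀ {h w a b} → (a , b) ∈ box h w → a < h × b < w
∈-box⁻ {suc h} {w} p∈ with ∈-++⁻ (box h w) p∈
... | inj₁ p∈box = Data.Product.map₁ m<n⇒m<1+n (∈-box⁻ p∈box)
... | inj₂ p∈row with ∈-map⁻ (h ,_) p∈row
...   | b , b∈ , refl = n<1+n h , ∈-upTo⁻ b∈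

⊆-by-decision : ∀ {S T} {ok : True (S ⊆? T)} → S ⊆ T
⊆-by-decision {ok = ok} = toWitness ok

InjectiveOn : (Point → ℕ) → List Point → Set
InjectiveOn ρ S = ∀ {p q} → p ∈ S → q ∈ S → ρ p ≡ ρ q → p ≡ q

before : (Point → ℕ) → Point → Point → Bool
before ρ p q = ρ q <ᵇ ρ p

Last : (Point → Bool) → List Point → Point → Set
Last earlier S p = p ∈ S × All (λ q → q ≡ p ⊎ T (earlier q)) S

last? : ∀ earlier S p → Dec (Last earlier S p)
last? earlier S p = p ∈? S ×-dec All.all? (λ q → (q ≟ₚ p) ⊎-dec T? (earlier q)) S

lastIn : (Point → Bool) → List Point → Point → Bool
lastIn earlier S p = does (last? earlier S p)

lastIn-cong : ∀ {earlier earlier′} → (∀ q → earlier q ≡ earlier′ q) →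
              ∀ S p → lastIn earlier S p ≡ lastIn earlier′ S p
lastIn-cong same S p = does-⇔ (mk⇔ (transport same) (transport (sym ∘ same))) (last? _ S p) (last? _ S p)
  where
  transport : ∀ {e e′} → (∀ q → e q ≡ e′ q) → Last e S p → Last e′ S p
  transport e≗e′ (p∈S , others) = p∈S , All.map (λ {q} → Sum.map₂ (subst T (e≗e′ q))) others

-- The ρ-largest point of S; (0 , 0) is a junk value for the empty list.
latest : (Point → ℕ) → List Point → Point
latest ρ [] = 0 , 0
latest ρ (p ∷ S) = argmax ρ p S

module _ (ρ : Point → ℕ) {x : Point} {xs : List Point} where

  latest∈ : latest ρ (x ∷ xs) ∈ x ∷ xs
  latest∈ with argmax-sel ρ x xs
  ... | inj₁ eq = subst (_∈ x ∷ xs) (sym eq) (here refl)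
  ... | inj₂ ∈xs = there ∈xs

  ≤-latest : ∀ {q} → q ∈ x ∷ xs → ρ q ≤ ρ (latest ρ (x ∷ xs))
  ≤-latest (here refl) = f[⊥]≤f[argmax] {f = ρ} x xs
  ≤-latest (there q∈) = All.lookup (f[xs]≤f[argmax] {f = ρ} x xs) q∈

latest-unique : ∀ ρ {S} → InjectiveOn ρ S → ∀ {p} → p ∈ S → (∀ {q} → q ∈ S → ρ q ≤ ρ p) →
                p ≡ latest ρ S
latest-unique ρ {x ∷ xs} inj p∈ maximal =
  inj p∈ (latest∈ ρ) (≤-antisym (≤-latest ρ p∈) (maximal (latest∈ ρ)))

lastIn-latest : ∀ ρ {x xs} → InjectiveOn ρ (x ∷ xs) →
                ∀ p → lastIn (before ρ p) (x ∷ xs) p ≡ (p == latest ρ (x ∷ xs))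
lastIn-latest ρ {x} {xs} inj p = does-⇔ (mk⇔ to from) (last? _ _ p) (p ≟ₚ _)
  where
  to : Last (before ρ p) (x ∷ xs) p → p ≡ latest ρ (x ∷ xs)
  to (p∈ , others) = latest-unique ρ inj p∈ λ q∈ → earlier (All.lookup others q∈)
    where
    earlier : ∀ {q} → q ≡ p ⊎ T (before ρ p q) → ρ q ≤ ρ p
    earlier (inj₁ refl) = ≤-refl
    earlier (inj₂ q<p) = <⇒≤ (<ᵇ⇒< _ _ q<p)
  from : p ≡ latest ρ (x ∷ xs) → Last (before ρ p) (x ∷ xs) p
  from refl = latest∈ ρ , All.tabulate earlier
    where
    earlier : ∀ {q} → q ∈ x ∷ xs → q ≡ p ⊎ T (before ρ p q)
    earlier {q} q∈ with q ≟ₚ p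
    ... | yes q≡p = inj₁ q≡p
    ... | no q≢p = inj₂ (<⇒<ᵇ (≤∧≢⇒< (≤-latest ρ q∈) (q≢p ∘ inj q∈ (latest∈ ρ))))

module _ (ρ : Point → ℕ) where

  latest-⊆ : ∀ {y ys x xs} → InjectiveOn ρ (x ∷ xs) → y ∷ ys ⊆ x ∷ xs →
             latest ρ (x ∷ xs) ∈ y ∷ ys → latest ρ (x ∷ xs) ≡ latest ρ (y ∷ ys)
  latest-⊆ inj sub ∈sub =
    latest-unique ρ (λ p∈ q∈ → inj (sub p∈) (sub q∈)) ∈sub λ q∈ → ≤-latest ρ (sub q∈)

  latest-++ : ∀ S T → InjectiveOn ρ (S ++ T) → latest ρ (S ++ T) ∈ latest ρ S ∷ latest ρ T ∷ []
  latest-++ [] T inj = there (here refl)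
  latest-++ (x ∷ xs) [] inj = here (cong (latest ρ) (++-identityʳ (x ∷ xs)))
  latest-++ (x ∷ xs) (y ∷ ys) inj with ∈-++⁻ (x ∷ xs) (latest∈ ρ {x} {xs ++ y ∷ ys})
  ... | inj₁ ∈left = here (latest-⊆ inj ∈-++⁺ˡ ∈left)
  ... | inj₂ ∈right = there (here (latest-⊆ inj (∈-++⁺ʳ (x ∷ xs)) ∈right))

column₀ column₂ row₀ row₂ ring : List Point
column₀ = (0 , 0) ∷ (1 , 0) ∷ []
column₂ = (0 , 2) ∷ (1 , 2) ∷ []
row₀ = (0 , 0) ∷ (0 , 1) ∷ []
row₂ = (2 , 0) ∷ (2 , 1) ∷ []
ring = (0 , 0) ∷ (0 , 1) ∷ (0 , 2) ∷ (1 , 2) ∷ (2 , 2) ∷ (2 , 1) ∷ (2 , 0) ∷ (1 , 0) ∷ []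

centre : Point
centre = 1 , 1

completesFirst : (List Point → Bool) → List Point → List Point → Bool
completesFirst isLast S T = (isLast S ∨ isLast T) ∧ not (isLast (S ++ T))

-- Whether the cell p of an h × w block is marked; isLast S tells whether p is the last
-- queried cell of S.
marks : ℕ → ℕ → (List Point → Bool) → Point → Bool
marks 2 2 isLast p = isLast (box 2 2)
marks 2 3 isLast p = isLast (box 2 3) ∨ completesFirst isLast column₀ column₂
marks 3 2 isLast p = isLast (box 3 2) ∨ completesFirst isLast row₀ row₂
marks 3 3 isLast p = (p == centre) ∨ isLast ring
marks _ _ _ _ = false

data Side : ℕ → Set where
  two : Side 2
  three : Side 3

marks-cong : ∀ {h w} → Side h → Side w → ∀ {isLast isLast′} p →
             (∀ {x xs} → x ∷ xs ⊆ box h w → isLast (x ∷ xs) ≡ isLast′ (x ∷ xs)) →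
             marks h w isLast p ≡ marks h w isLast′ p
marks-cong two two p same = same ⊆-by-decision
marks-cong two three p same = cong₂ _∨_ (same ⊆-by-decision)
  (cong₂ _∧_ (cong₂ _∨_ (same ⊆-by-decision) (same ⊆-by-decision)) (cong not (same ⊆-by-decision)))
marks-cong three two p same = cong₂ _∨_ (same ⊆-by-decision)
  (cong₂ _∧_ (cong₂ _∨_ (same ⊆-by-decision) (same ⊆-by-decision)) (cong not (same ⊆-by-decision)))
marks-cong three three p same = cong ((p == centre) ∨_) (same ⊆-by-decision)

marked predicted : ℕ → ℕ → (Point → ℕ) → Point → Bool
marked h w ρ p = marks h w (λ S → lastIn (before ρ p) S p) p
predicted h w ρ p = marks h w (λ S → p == latest ρ S) p

marked≡predicted : ∀ {h w} → Side h → Side w → ∀ ρ → InjectiveOn ρ (box h w) →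
                   ∀ p → marked h w ρ p ≡ predicted h w ρ p
marked≡predicted sh sw ρ inj p =
  marks-cong sh sw p λ sub → lastIn-latest ρ (λ p∈ q∈ → inj (sub p∈) (sub q∈)) p

-- Certificates for the final patterns of a block

Loop : Set
Loop = Σ ℕ λ r → Vec Point (3 + r)

IsLoop : Loop → Set
IsLoop (r , ps) =
  (∀ x y → lookup ps x ≡ lookup ps y → x ≡ y) ×
  (∀ x → Adjacent (lookup ps (inject₁ x)) (lookup ps (fsuc x))) ×
  Adjacent (lookup ps (fromℕ (2 + r))) (lookup ps fzero)

isLoop? : ∀ ℓ → Dec (IsLoop ℓ)
isLoop? (r , ps) =
  Fin.all? (λ x → Fin.all? λ y → (lookup ps x ≟ₚ lookup ps y) →-dec (x Fin.≟ y)) ×-dec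
  Fin.all? (λ x → adjacent? (lookup ps (inject₁ x)) (lookup ps (fsuc x))) ×-dec
  adjacent? (lookup ps (fromℕ (2 + r))) (lookup ps fzero)

square : Point → Loop
square (a , b) = 1 , fromList ((a , b) ∷ (a , suc b) ∷ (suc a , suc b) ∷ (suc a , b) ∷ [])

loops : ℕ → ℕ → List Loop
loops 3 3 = (5 , fromList ring) ∷ map square (box 2 2)
loops h w = map square (box (h ∸ 1) (w ∸ 1))

Orientation : Set
Orientation = Bool × Bool

orientations : List Orientation
orientations = (false , false) ∷ (false , true) ∷ (true , false) ∷ (true , true) ∷ []

mirror : Bool → ℕ → ℕ
mirror true a = 2 ∸ a
mirror false a = a

-- The lexicographic order on a 3 × 3 box, with rows and columns possibly reversed.
key : Orientation → Point → ℕ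
key (flipRows , flipColumns) (a , b) = 3 * mirror flipRows a + mirror flipColumns b

Separates : ℕ → ℕ → (Point → ℕ) → Set
Separates h w height = All (λ p → All (λ q → Adjacent p q → height p ≢ height q) (box h w)) (box h w)

OneLower : ℕ → ℕ → (Point → Bool) → (Point → ℕ) → Set
OneLower h w marking height = All (λ p → All (λ q → All (λ q′ →
  Adjacent p q → Adjacent p q′ → marking q ≡ marking p → marking q′ ≡ marking p →
  height q < height p → height q′ < height p → q ≡ q′) (box h w)) (box h w)) (box h w)

Closes : ℕ → ℕ → (Point → Bool) → Point → Loop → Set
Closes h w marking v (r , ps) =
  IsLoop (r , ps) × ∀ x → lookup ps x ∈ box h w × (lookup ps x ≡ v ⊎ marking (lookup ps x) ≡ false)

separates? : ∀ h w height → Dec (Separates h w height)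
separates? h w height =
  All.all? (λ p → All.all? (λ q → adjacent? p q →-dec ¬? (height p ≟ height q)) (box h w)) (box h w)

oneLower? : ∀ h w marking height → Dec (OneLower h w marking height)
oneLower? h w marking height = All.all? (λ p → All.all? (λ q → All.all? (λ q′ →
  adjacent? p q →-dec adjacent? p q′ →-dec (marking q ≟ᵇ marking p) →-dec (marking q′ ≟ᵇ marking p) →-dec
  (height q <? height p) →-dec (height q′ <? height p) →-dec (q ≟ₚ q′)) (box h w)) (box h w)) (box h w)

closes? : ∀ h w marking v ℓ → Dec (Closes h w marking v ℓ)
closes? h w marking v (r , ps) = isLoop? (r , ps) ×-dec
  Fin.all? (λ x → (lookup ps x ∈? box h w) ×-dec ((lookup ps x ≟ₚ v) ⊎-dec (marking (lookup ps x) ≟ᵇ false)))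

orientFor : ℕ → ℕ → (Point → Bool) → Orientation
orientFor h w marking =
  fromMaybe (false , false) (head (filter (λ o → oneLower? h w marking (key o)) orientations))

heightFor : ℕ → ℕ → (Point → Bool) → Point → ℕ
heightFor h w marking = key (orientFor h w marking)

-- marking is the final pattern of a block and v its last queried cell.
record Good (h w : ℕ) (marking : Point → Bool) (v : Point) : Set where
  field
    separates : Separates h w (heightFor h w marking)
    one-lower : OneLower h w marking (heightFor h w marking)
    closes : Any (Closes h w marking v) (loops h w)

good? : ∀ h w marking v → Dec (Good h w marking v)
good? h w marking v = map′ (λ (s , o , c) → record { separates = s ; one-lower = o ; closes = c })
  (λ g → Good.separates g , Good.one-lower g , Good.closes g)
  (separates? h w (heightFor h w marking) ×-dec oneLower? h w marking (heightFor h w marking) ×-dec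
   Any.any? (closes? h w marking v) (loops h w))

good-2×2 : All (λ v → Good 2 2 (_== v) v) (box 2 2)
good-2×2 = toWitness {a? = All.all? (λ v → good? 2 2 (_== v) v) (box 2 2)} _

good-3×3 : All (λ v → All (λ r → (v ∈ ring → v ≡ r) → Good 3 3 (λ p → (p == centre) ∨ (p == r)) v) ring)
               (box 3 3)
good-3×3 = toWitness {a? = All.all? (λ v → All.all? (λ r →
  ((v ∈? ring) →-dec (v ≟ₚ r)) →-dec good? 3 3 (λ p → (p == centre) ∨ (p == r)) v) ring) (box 3 3)} _

endPattern : Point → Point → Point → Point → Point → Bool
endPattern v l₀ l₂ l p = (p == v) ∨ (((p == l₀) ∨ (p == l₂)) ∧ not (p == l))

-- v, l₀, l₂ and l range over the possible latest cells of the block, of S, of T and of S ++ T.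
EndsGood : ℕ → ℕ → List Point → List Point → Set
EndsGood h w S T = All (λ v → All (λ l₀ → All (λ l₂ → All (λ l →
  (v ∈ S ++ T → v ≡ l) → Good h w (endPattern v l₀ l₂ l) v) (l₀ ∷ l₂ ∷ [])) T) S) (box h w)

endsGood? : ∀ h w S T → Dec (EndsGood h w S T)
endsGood? h w S T = All.all? (λ v → All.all? (λ l₀ → All.all? (λ l₂ → All.all? (λ l →
  ((v ∈? S ++ T) →-dec (v ≟ₚ l)) →-dec good? h w (endPattern v l₀ l₂ l) v) (l₀ ∷ l₂ ∷ [])) T) S) (box h w)

good-2×3 : EndsGood 2 3 column₀ column₂
good-2×3 = toWitness {a? = endsGood? 2 3 column₀ column₂} _

good-3×2 : EndsGood 3 2 row₀ row₂
good-3×2 = toWitness {a? = endsGood? 3 2 row₀ row₂} _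

predicted-good : ∀ {h w} → Side h → Side w → ∀ ρ → InjectiveOn ρ (box h w) →
                 Good h w (predicted h w ρ) (latest ρ (box h w))
predicted-good two two ρ inj = All.lookup good-2×2 (latest∈ ρ)
predicted-good two three ρ inj =
  All.lookup (All.lookup (All.lookup (All.lookup good-2×3 (latest∈ ρ)) (latest∈ ρ)) (latest∈ ρ))
    (latest-++ ρ column₀ column₂ (λ p∈ q∈ → inj (⊆-by-decision p∈) (⊆-by-decision q∈)))
    (latest-⊆ ρ inj ⊆-by-decision)
predicted-good three two ρ inj =
  All.lookup (All.lookup (All.lookup (All.lookup good-3×2 (latest∈ ρ)) (latest∈ ρ)) (latest∈ ρ))
    (latest-++ ρ row₀ row₂ (λ p∈ q∈ → inj (⊆-by-decision p∈) (⊆-by-decision q∈)))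
    (latest-⊆ ρ inj ⊆-by-decision)
predicted-good three three ρ inj =
  All.lookup (All.lookup good-3×3 (latest∈ ρ)) (latest∈ ρ) (latest-⊆ ρ inj ⊆-by-decision)

-- Cutting a line of length 2 + d into blocks of length 2, the last one of length 3 when d is odd

blockStart : ℕ → ℕ
blockStart zero = 0
blockStart (suc b) = suc (suc (blockStart b))

block offset width : ℕ → ℕ → ℕ
block (suc (suc d)) (suc (suc i)) = suc (block d i)
block _ _ = 0
offset (suc (suc d)) (suc (suc i)) = offset d i
offset _ i = i
width (suc (suc d)) zero = 2
width (suc (suc d)) (suc b) = width d b
width d _ = 2 + d

block-decomposes : ∀ d {i} → blockStart (block d i) + offset d i ≡ i
block-decomposes zero = refl
block-decomposes (suc zero) = refl
block-decomposes (suc (suc d)) {zero} = refl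
block-decomposes (suc (suc d)) {suc zero} = refl
block-decomposes (suc (suc d)) {suc (suc i)} = cong (suc ∘ suc) (block-decomposes d)

offset<width : ∀ d {i} → i < 2 + d → offset d i < width d (block d i)
offset<width zero i< = i<
offset<width (suc zero) i< = i<
offset<width (suc (suc d)) {zero} _ = z<s
offset<width (suc (suc d)) {suc zero} _ = s<s z<s
offset<width (suc (suc d)) {suc (suc i)} (s<s (s<s i<)) = offset<width d i<

width-side : ∀ d {i} → i < 2 + d → Side (width d (block d i))
width-side zero _ = two
width-side (suc zero) _ = three
width-side (suc (suc d)) {zero} _ = two
width-side (suc (suc d)) {suc zero} _ = two
width-side (suc (suc d)) {suc (suc i)} (s<s (s<s i<)) = width-side d i<

block-members : ∀ d {i a} → i < 2 + d → a < width d (block d i) →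
  blockStart (block d i) + a < 2 + d × block d (blockStart (block d i) + a) ≡ block d i ×
  offset d (blockStart (block d i) + a) ≡ a
block-members zero _ a< = a< , refl , refl
block-members (suc zero) _ a< = a< , refl , refl
block-members (suc (suc d)) {zero} {zero} _ _ = z<s , refl , refl
block-members (suc (suc d)) {zero} {suc zero} _ _ = s<s z<s , refl , refl
block-members (suc (suc d)) {suc zero} {zero} _ _ = z<s , refl , refl
block-members (suc (suc d)) {suc zero} {suc zero} _ _ = s<s z<s , refl , refl
block-members (suc (suc d)) {zero} {suc (suc a)} _ (s<s (s<s ()))
block-members (suc (suc d)) {suc zero} {suc (suc a)} _ (s<s (s<s ()))
block-members (suc (suc d)) {suc (suc i)} (s<s (s<s i<)) a< with block-members d i< a<
... | in-range , same-block , same-offset = s<s (s<s in-range) , cong suc same-block , same-offset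

block-zero : ∀ d → block d 0 ≡ 0
block-zero zero = refl
block-zero (suc zero) = refl
block-zero (suc (suc d)) = refl

block-step : ∀ d {i} → block d (suc i) ≡ block d i ⊎ block d (suc i) ≡ suc (block d i)
block-step zero = inj₁ refl
block-step (suc zero) = inj₁ refl
block-step (suc (suc d)) {zero} = inj₁ refl
block-step (suc (suc d)) {suc zero} = inj₂ (cong suc (block-zero d))
block-step (suc (suc d)) {suc (suc i)} = Sum.map (cong suc) (cong suc) (block-step d)

parity-suc : ∀ b → parity (suc b) ≢ parity b
parity-suc b eq = p≢p⁻¹ _ (trans eq (sym (suc-homo-⁻¹ b)))

neighbouring-blocks : ∀ d {x y} → ∣ x - y ∣ ≡ 1 →
                      block d x ≡ block d y ⊎ parity (block d x) ≢ parity (block d y)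
neighbouring-blocks d {x} {y} dist with distance-one {x} {y} dist
... | inj₁ refl =
  Sum.map sym (λ next eq → parity-suc (block d x) (trans (cong parity (sym next)) (sym eq))) (block-step d)
... | inj₂ refl =
  Sum.map id (λ next eq → parity-suc (block d y) (trans (cong parity (sym next)) eq)) (block-step d)

-- The adversary on a (2 + M) × (2 + N) grid

module Strategy (M N : ℕ) {k : ℕ} (4≤k : 4 ≤ k) where

  Grid : Set
  Grid = Cell (2 + M) (2 + N)

  point : Grid → Point
  point (i , j) = toℕ i , toℕ j

  record InGrid (p : Point) : Set where
    constructor inGrid
    field
      row< : proj₁ p < 2 + M
      column< : proj₂ p < 2 + N

  point-in-grid : ∀ u → InGrid (point u)
  point-in-grid (i , j) = inGrid (Fin.toℕ<n i) (Fin.toℕ<n j)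

  -- Out-of-range numbers are sent to the junk value fzero.
  clamp : ∀ {L} → ℕ → Fin (suc L)
  clamp {L} a with a <? suc L
  ... | yes a< = fromℕ< a<
  ... | no _ = fzero

  toℕ-clamp : ∀ {L a} → a < suc L → toℕ (clamp {L} a) ≡ a
  toℕ-clamp {L} {a} a< with a <? suc L
  ... | yes _ = Fin.toℕ-fromℕ< _
  ... | no a≮ = contradiction a< a≮

  cellAt : Point → Grid
  cellAt (a , b) = clamp a , clamp b

  point-cellAt : ∀ {p} → InGrid p → point (cellAt p) ≡ p
  point-cellAt (inGrid a< b<) = cong₂ _,_ (toℕ-clamp a<) (toℕ-clamp b<)

  cellAt-point : ∀ u → cellAt (point u) ≡ u
  cellAt-point (i , j) =
    cong₂ _,_ (Fin.toℕ-injective (toℕ-clamp (Fin.toℕ<n i))) (Fin.toℕ-injective (toℕ-clamp (Fin.toℕ<n j)))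

  Block : Set
  Block = ℕ × ℕ

  blockOf : Point → Block
  blockOf (a , b) = block M a , block N b

  offsetOf : Point → Point
  offsetOf (a , b) = offset M a , offset N b

  originOf : Block → Point
  originOf (r , s) = blockStart r , blockStart s

  rowsOf columnsOf : Block → ℕ
  rowsOf (r , s) = width M r
  columnsOf (r , s) = width N s

  tint : Block → Parity
  tint (r , s) = parity r ⊹ parity s

  code : Parity → Bool → Fin 4
  code 0ℙ false = fzero
  code 0ℙ true = fsuc fzero
  code 1ℙ false = fsuc (fsuc fzero)
  code 1ℙ true = fsuc (fsuc (fsuc fzero))

  decode : Fin 4 → Parity × Bool
  decode fzero = 0ℙ , false
  decode (fsuc fzero) = 0ℙ , true
  decode (fsuc (fsuc fzero)) = 1ℙ , false
  decode (fsuc (fsuc (fsuc _))) = 1ℙ , true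

  decode-code : ∀ p b → decode (code p b) ≡ (p , b)
  decode-code 0ℙ false = refl
  decode-code 0ℙ true = refl
  decode-code 1ℙ false = refl
  decode-code 1ℙ true = refl

  colour : Parity → Bool → Fin k
  colour p b = inject≤ (code p b) 4≤k

  colour-injective : ∀ {p b p′ b′} → colour p b ≡ colour p′ b′ → p ≡ p′ × b ≡ b′
  colour-injective {p} {b} {p′} {b′} eq =
    ,-injective (trans (sym (decode-code p b))
                       (trans (cong decode (Fin.inject≤-injective _ _ _ _ eq)) (decode-code p′ b′)))

  localRank : (Grid → ℕ) → Block → Point → ℕ
  localRank ρ B q = ρ (cellAt (originOf B ⊕ q))

  markIn : (Grid → ℕ) → Block → Point → Bool
  markIn ρ B = marked (rowsOf B) (columnsOf B) (localRank ρ B)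

  paint : (Grid → ℕ) → Point → Fin k
  paint ρ p = colour (tint (blockOf p)) (markIn ρ (blockOf p) (offsetOf p))

  strategy : (Grid → ℕ) → Coloring (2 + M) (2 + N) k
  strategy ρ i j = paint ρ (point (i , j))

  boxOf : Block → List Point
  boxOf B = box (rowsOf B) (columnsOf B)

  decompose : ∀ p → originOf (blockOf p) ⊕ offsetOf p ≡ p
  decompose (a , b) = cong₂ _,_ (block-decomposes M) (block-decomposes N)

  anchor : ∀ u → cellAt (originOf (blockOf (point u)) ⊕ offsetOf (point u)) ≡ u
  anchor u = trans (cong cellAt (decompose (point u))) (cellAt-point u)

  module _ {p : Point} (p∈ : InGrid p) where

    sides : Side (rowsOf (blockOf p)) × Side (columnsOf (blockOf p))
    sides = width-side M (InGrid.row< p∈) , width-side N (InGrid.column< p∈)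

    offset∈box : offsetOf p ∈ boxOf (blockOf p)
    offset∈box = ∈-box⁺ (offset<width M (InGrid.row< p∈)) (offset<width N (InGrid.column< p∈))

    member : ∀ {q} → q ∈ boxOf (blockOf p) →
             InGrid (originOf (blockOf p) ⊕ q) × blockOf (originOf (blockOf p) ⊕ q) ≡ blockOf p ×
             offsetOf (originOf (blockOf p) ⊕ q) ≡ q
    member q∈ with ∈-box⁻ q∈
    ... | x< , y< with block-members M (InGrid.row< p∈) x< | block-members N (InGrid.column< p∈) y<
    ...   | x-in , x-block , x-offset | y-in , y-block , y-offset =
      inGrid x-in y-in , cong₂ _,_ x-block y-block , cong₂ _,_ x-offset y-offset

    localRank-injective : ∀ {ρ} → Injective _≡_ _≡_ ρ →
                          InjectiveOn (localRank ρ (blockOf p)) (boxOf (blockOf p))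
    localRank-injective ρ-injective {q} {q′} q∈ q′∈ same-rank = begin
      q                                    ≡⟨ member q∈ .proj₂ .proj₂ ⟨
      offsetOf (o ⊕ q)                     ≡⟨ cong offsetOf (point-cellAt (member q∈ .proj₁)) ⟨
      offsetOf (point (cellAt (o ⊕ q)))    ≡⟨ cong (offsetOf ∘ point) (ρ-injective same-rank) ⟩
      offsetOf (point (cellAt (o ⊕ q′)))   ≡⟨ cong offsetOf (point-cellAt (member q′∈ .proj₁)) ⟩
      offsetOf (o ⊕ q′)                    ≡⟨ member q′∈ .proj₂ .proj₂ ⟩
      q′                                   ∎
      where
      open ≡-Reasoning
      o : Point
      o = originOf (blockOf p)

  adjacent-same-tint : ∀ {p q} → Adjacent p q → tint (blockOf p) ≡ tint (blockOf q) → blockOf p ≡ blockOf q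
  adjacent-same-tint {a , b} {c , d} adj same with adjacent-split {a} {b} {c} {d} adj
  ... | inj₁ (refl , dist) = cong (block M a ,_)
    ([ id , (λ ≢ → contradiction (⊹-cancelˡ-≡ (parity (block M a)) _ _ same) ≢) ]′ (neighbouring-blocks N dist))
  ... | inj₂ (dist , refl) = cong (_, block N b)
    ([ id , (λ ≢ → contradiction (⊹-cancelʳ-≡ (parity (block N b)) _ _ same) ≢) ]′ (neighbouring-blocks M dist))

  loop-cycle : ∀ {c : Coloring (2 + M) (2 + N) k} o {r ps} → IsLoop (r , ps) →
               (∀ x → InGrid (o ⊕ lookup ps x)) → ∀ {a} → (∀ x → colorOf c (cellAt (o ⊕ lookup ps x)) ≡ a) →
               HasCycle c
  loop-cycle {c} o {r} {ps} (injective , steps , closing) in-grid coloured =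
    r , record { vertex = vertex ; distinct = distinct ; step = λ x → edge (steps x) ; close = edge closing }
    where
    vertex : Fin (3 + r) → Grid
    vertex x = cellAt (o ⊕ lookup ps x)
    located : ∀ x → point (vertex x) ≡ o ⊕ lookup ps x
    located x = point-cellAt (in-grid x)
    distinct : Injective _≡_ _≡_ vertex
    distinct {x} {y} eq = injective x y (⊕-cancel o (trans (sym (located x)) (trans (cong point eq) (located y))))
    edge : ∀ {x y} → Adjacent (lookup ps x) (lookup ps y) → Edge c (vertex x) (vertex y)
    edge {x} {y} adj = subst₂ Adjacent (sym (located x)) (sym (located y)) (⊕-adjacent⁺ o adj) ,
                       trans (coloured x) (sym (coloured y))

  online : ∀ ρ ρ′ u → (∀ z → (ρ z <ᵇ ρ u) ≡ (ρ′ z <ᵇ ρ′ u)) →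
           colorOf (strategy ρ) u ≡ colorOf (strategy ρ′) u
  online ρ ρ′ u same-order = cong (colour (tint B))
    (marks-cong (sides u∈ .proj₁) (sides u∈ .proj₂) q₀ λ {x} {xs} _ → lastIn-cong same-before (x ∷ xs) q₀)
    where
    B : Block
    B = blockOf (point u)
    q₀ : Point
    q₀ = offsetOf (point u)
    u∈ : InGrid (point u)
    u∈ = point-in-grid u
    same-before : ∀ q → before (localRank ρ B) q₀ q ≡ before (localRank ρ′ B) q₀ q
    same-before q = begin
      ρ z <ᵇ ρ (cellAt (originOf B ⊕ q₀))    ≡⟨ cong ((ρ z <ᵇ_) ∘ ρ) (anchor u) ⟩
      ρ z <ᵇ ρ u                             ≡⟨ same-order z ⟩
      ρ′ z <ᵇ ρ′ u                           ≡⟨ cong ((ρ′ z <ᵇ_) ∘ ρ′) (anchor u) ⟨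
      ρ′ z <ᵇ ρ′ (cellAt (originOf B ⊕ q₀))  ∎
      where
      open ≡-Reasoning
      z : Grid
      z = cellAt (originOf B ⊕ q)

  module Analysis (ρ : Grid → ℕ) (ρ-injective : Injective _≡_ _≡_ ρ) where

    predictedIn : Block → Point → Bool
    predictedIn B = predicted (rowsOf B) (columnsOf B) (localRank ρ B)

    heightIn : Block → Point → ℕ
    heightIn B = heightFor (rowsOf B) (columnsOf B) (predictedIn B)

    module _ {p : Point} (p∈ : InGrid p) where

      good : Good (rowsOf (blockOf p)) (columnsOf (blockOf p)) (predictedIn (blockOf p))
                  (latest (localRank ρ (blockOf p)) (boxOf (blockOf p)))
      good = predicted-good (sides p∈ .proj₁) (sides p∈ .proj₂) (localRank ρ (blockOf p))
                            (localRank-injective p∈ ρ-injective)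

      predicts : ∀ q → markIn ρ (blockOf p) q ≡ predictedIn (blockOf p) q
      predicts = marked≡predicted (sides p∈ .proj₁) (sides p∈ .proj₂) (localRank ρ (blockOf p))
                                  (localRank-injective p∈ ρ-injective)

    heightAt : Grid → ℕ
    heightAt u = heightIn (blockOf (point u)) (offsetOf (point u))

    module _ {u w} (e : Edge (strategy ρ) u w) where

      same-block : blockOf (point w) ≡ blockOf (point u)
      same-block = sym (adjacent-same-tint (proj₁ e) (colour-injective (proj₂ e) .proj₁))

      offsets-adjacent : Adjacent (offsetOf (point u)) (offsetOf (point w))
      offsets-adjacent = ⊕-adjacent⁻ (originOf (blockOf (point u)))
        (subst₂ Adjacent (sym (decompose (point u))) (sym w-decomposes) (proj₁ e))
        where
        w-decomposes : originOf (blockOf (point u)) ⊕ offsetOf (point w) ≡ point w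
        w-decomposes = trans (cong (λ B → originOf B ⊕ offsetOf (point w)) (sym same-block)) (decompose (point w))

      w-in-box : offsetOf (point w) ∈ boxOf (blockOf (point u))
      w-in-box = subst (λ B → offsetOf (point w) ∈ boxOf B) same-block (offset∈box (point-in-grid w))

      same-prediction : predictedIn (blockOf (point u)) (offsetOf (point w)) ≡
                        predictedIn (blockOf (point u)) (offsetOf (point u))
      same-prediction = begin
        predictedIn (blockOf (point u)) (offsetOf (point w))  ≡⟨ predicts (point-in-grid u) _ ⟨
        markIn ρ (blockOf (point u)) (offsetOf (point w))     ≡⟨ cong (λ B → markIn ρ B (offsetOf (point w))) same-block ⟨
        markIn ρ (blockOf (point w)) (offsetOf (point w))     ≡⟨ colour-injective (proj₂ e) .proj₂ ⟨
        markIn ρ (blockOf (point u)) (offsetOf (point u))     ≡⟨ predicts (point-in-grid u) _ ⟩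
        predictedIn (blockOf (point u)) (offsetOf (point u))  ∎
        where open ≡-Reasoning

      height-of-w : heightAt w ≡ heightIn (blockOf (point u)) (offsetOf (point w))
      height-of-w = cong (λ B → heightIn B (offsetOf (point w))) same-block

    separated : ∀ {u w} → Edge (strategy ρ) u w → heightAt u ≢ heightAt w
    separated {u} {w} e eq =
      All.lookup (All.lookup (Good.separates (good u∈)) (offset∈box u∈)) (w-in-box {u} {w} e)
        (offsets-adjacent {u} {w} e) (trans eq (height-of-w {u} {w} e))
      where
      u∈ : InGrid (point u)
      u∈ = point-in-grid u

    one-lower : ∀ {u w w′} → Edge (strategy ρ) u w → Edge (strategy ρ) u w′ →
                heightAt w < heightAt u → heightAt w′ < heightAt u → w ≡ w′
    one-lower {u} {w} {w′} e e′ below below′ = begin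
      w                                                             ≡⟨ anchor w ⟨
      cellAt (originOf (blockOf (point w)) ⊕ offsetOf (point w))    ≡⟨ cong₂ (λ B q → cellAt (originOf B ⊕ q))
                                                                               same-block′ same-offset ⟩
      cellAt (originOf (blockOf (point w′)) ⊕ offsetOf (point w′))  ≡⟨ anchor w′ ⟩
      w′                                                            ∎
      where
      open ≡-Reasoning
      u∈ : InGrid (point u)
      u∈ = point-in-grid u
      same-block′ : blockOf (point w) ≡ blockOf (point w′)
      same-block′ = trans (same-block {u} {w} e) (sym (same-block {u} {w′} e′))
      lower : ∀ {x} → Edge (strategy ρ) u x → heightAt x < heightAt u →
              heightIn (blockOf (point u)) (offsetOf (point x)) < heightAt u
      lower {x} e below = subst (_< heightAt u) (height-of-w {u} {x} e) below
      same-offset : offsetOf (point w) ≡ offsetOf (point w′)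
      same-offset = All.lookup (All.lookup (All.lookup (Good.one-lower (good u∈)) (offset∈box u∈))
        (w-in-box {u} {w} e)) (w-in-box {u} {w′} e′) (offsets-adjacent {u} {w} e) (offsets-adjacent {u} {w′} e′)
        (same-prediction {u} {w} e) (same-prediction {u} {w′} e′) (lower {w} e below) (lower {w′} e′ below′)

    acyclic : ¬ HasCycle (strategy ρ)
    acyclic = acyclic-by-height (strategy ρ) heightAt
      (λ {u} {w} → separated {u} {w}) (λ {u} {w} {w′} → one-lower {u} {w} {w′})

    switch : ∀ v → (∀ z → ρ z ≤ ρ v) →
             ∃ λ a → ¬ HasCycle (strategy ρ) × HasCycle (recolour (strategy ρ) v a)
    switch v v-last = base , acyclic , closed-loop (Any.satisfied (Good.closes (good v∈)))
      where
      B : Block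
      B = blockOf (point v)
      v∈ : InGrid (point v)
      v∈ = point-in-grid v
      base : Fin k
      base = colour (tint B) false
      v-latest : offsetOf (point v) ≡ latest (localRank ρ B) (boxOf B)
      v-latest = latest-unique (localRank ρ B) (localRank-injective v∈ ρ-injective) (offset∈box v∈)
        (λ {q} _ → subst (localRank ρ B q ≤_) (sym (cong ρ (anchor v))) (v-last _))
      painted : ∀ {q} → q ∈ boxOf B → predictedIn B q ≡ false →
                colorOf (strategy ρ) (cellAt (originOf B ⊕ q)) ≡ base
      painted {q} q∈ unmarked with member v∈ q∈
      ... | in-grid , same-block , same-offset = begin
        paint ρ (point (cellAt (originOf B ⊕ q)))  ≡⟨ cong (paint ρ) (point-cellAt in-grid) ⟩
        paint ρ (originOf B ⊕ q)                    ≡⟨ cong₂ (λ B′ q′ → colour (tint B′) (markIn ρ B′ q′))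
                                                             same-block same-offset ⟩
        colour (tint B) (markIn ρ B q)              ≡⟨ cong (colour (tint B)) (trans (predicts v∈ q) unmarked) ⟩
        base                                        ∎
        where open ≡-Reasoning
      closed-loop : ∃ (Closes (rowsOf B) (columnsOf B) (predictedIn B) (latest (localRank ρ B) (boxOf B))) →
                    HasCycle (recolour (strategy ρ) v base)
      closed-loop ((r , ps) , is-loop , inside) =
        loop-cycle {recolour (strategy ρ) v base} (originOf B) {r} {ps} is-loop
          (λ x → member v∈ (proj₁ (inside x)) .proj₁) coloured
        where
        coloured : ∀ x → colorOf (recolour (strategy ρ) v base) (cellAt (originOf B ⊕ lookup ps x)) ≡ base
        coloured x with cellAt (originOf B ⊕ lookup ps x) ≟ᶜ v | inside x
        ... | yes _ | _ = refl
        ... | no ≢v | _ , inj₁ latest = contradiction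
          (trans (cong (λ q → cellAt (originOf B ⊕ q)) (trans latest (sym v-latest))) (anchor v)) ≢v
        ... | no _ | q∈ , inj₂ unmarked = painted q∈ unmarked

theorem1 : (m n k : ℕ) → 2 ≤ m → 2 ≤ n → 4 ≤ k →
    (t : Tree m n k) →
    ((c : Coloring m n k) → (eval t c ≡ true) ⇔ HasCycle c) →
    ∃ λ (c : Coloring m n k) → (i : _) → (j : _) → Queried t c i j
theorem1 (suc (suc M)) (suc (suc N)) k (s≤s (s≤s z≤n)) (s≤s (s≤s z≤n)) 4≤k = evasive
  where
  open Strategy M N 4≤k
  open Adversary strategy online HasCycle Analysis.switch
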